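{- For every integer $n\ge 2$, $$\Big(\sum_{j=1}^{7n-12} j+(8n-12)+(3n-3)\Big)^2=\sum_{j=1}^{7n-12} j^3+(8n-12)^3+(3n-3)^3,$$ and the equality remains valid when $3n-3$ is replaced by $5n-8$ on both sides, i.e. $$\Big(\sum_{j=1}^{7n-12} j+(8n-12)+(5n-8)\Big)^2=\sum_{j=1}^{7n-12} j^3+(8n-12)^3+(5n-8)^3.$$ -}

module Defs where

open import Data.Nat using (ℕ; zero; suc; _+_; _*_; _^_)

sumTo : (ℕ → ℕ) → ℕ → ℕ
sumTo f zero    = 0
sumTo f (suc N) = sumTo f N + f (suc N)

-- By Nicomachus, 1³ + ⋯ + N³ = T², where T = 1 + ⋯ + N and 2T = N(N+1).  Appending two
-- terms a, b to both sides therefore preserves "sum of cubes = square of sum" exactly when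
-- a³ + b³ = (a + b)(2T + a + b), i.e. when a² − ab + b² = N(N+1) + a + b.  With N = 7n − 12,
-- a = 8n − 12 and b ∈ {3n − 3, 5n − 8} this last equation is a quadratic identity in n.
module Submission where

open import Defs
open import Data.Nat using (ℕ; zero; suc; _+_; _*_; _∸_; _^_; _≤_; s≤s; z≤n)
open import Data.Nat.Properties using (+-assoc; +-comm; +-cancelʳ-≡; *-distribˡ-+; m+n∸n≡m)
open import Data.Nat.Solver using (module +-*-Solver)
open import Data.Nat.Tactic.RingSolver using (solve-∀)
open import Data.Product using (_×_; _,_)
open import Relation.Binary.PropositionalEquality using (_≡_; refl; sym; trans; cong; module ≡-Reasoning)

open +-*-Solver using (solve; _:+_; _:*_; _:^_; con; _:=_)
open ≡-Reasoning

2*sumTo-id≡N*suc-N : ∀ N → 2 * sumTo (λ j → j) N ≡ N * suc N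
2*sumTo-id≡N*suc-N zero    = refl
2*sumTo-id≡N*suc-N (suc N) = begin
  2 * (T + suc N)         ≡⟨ *-distribˡ-+ 2 T (suc N) ⟩
  2 * T + 2 * suc N       ≡⟨ cong (_+ 2 * suc N) (2*sumTo-id≡N*suc-N N) ⟩
  N * suc N + 2 * suc N   ≡⟨ solve 1 (λ n → n :* (con 1 :+ n) :+ con 2 :* (con 1 :+ n)
                                         := (con 1 :+ n) :* (con 2 :+ n)) refl N ⟩
  suc N * suc (suc N)     ∎
  where T = sumTo (λ j → j) N

sumTo-cube≡sumTo-id² : ∀ N → sumTo (λ j → j ^ 3) N ≡ sumTo (λ j → j) N ^ 2
sumTo-cube≡sumTo-id² zero    = refl
sumTo-cube≡sumTo-id² (suc N) = begin
  sumTo (λ j → j ^ 3) N + suc N ^ 3          ≡⟨ cong (_+ suc N ^ 3) (sumTo-cube≡sumTo-id² N) ⟩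
  T ^ 2 + suc N ^ 3                           ≡⟨ cong (T ^ 2 +_) cube-split ⟩
  T ^ 2 + (N * suc N * suc N + suc N ^ 2)     ≡⟨ cong (λ x → T ^ 2 + (x * suc N + suc N ^ 2)) (sym (2*sumTo-id≡N*suc-N N)) ⟩
  T ^ 2 + (2 * T * suc N + suc N ^ 2)         ≡⟨ solve 2 (λ t n → t :^ 2 :+ (con 2 :* t :* n :+ n :^ 2) := (t :+ n) :^ 2) refl T (suc N) ⟩
  (T + suc N) ^ 2                             ∎
  where
  T = sumTo (λ j → j) N
  cube-split : suc N ^ 3 ≡ N * suc N * suc N + suc N ^ 2
  cube-split = solve 1 (λ n → (con 1 :+ n) :^ 3 := n :* (con 1 :+ n) :* (con 1 :+ n) :+ (con 1 :+ n) :^ 2) refl N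

-- a³ + b³ = (a + b)(a² − ab + b²), with the subtraction moved across as ab(a + b).
^3-+-^3≡[a+b]*[x+a+b] : ∀ x a b → x + a + b + a * b ≡ a * a + b * b →
                        a ^ 3 + b ^ 3 ≡ (a + b) * (x + a + b)
^3-+-^3≡[a+b]*[x+a+b] x a b eq = +-cancelʳ-≡ (a * b * (a + b)) _ _ (begin
  a ^ 3 + b ^ 3 + a * b * (a + b)             ≡⟨ solve 2 (λ a b → a :^ 3 :+ b :^ 3 :+ a :* b :* (a :+ b)
                                                             := (a :+ b) :* (a :* a :+ b :* b)) refl a b ⟩
  (a + b) * (a * a + b * b)                   ≡⟨ cong ((a + b) *_) (sym eq) ⟩
  (a + b) * (x + a + b + a * b)               ≡⟨ solve 4 (λ x a b p → (a :+ b) :* (x :+ a :+ b :+ p)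
                                                             := (a :+ b) :* (x :+ a :+ b) :+ p :* (a :+ b)) refl x a b (a * b) ⟩
  (a + b) * (x + a + b) + a * b * (a + b)     ∎)

[t+a+b]²≡t²+a³+b³ : ∀ t a b → a ^ 3 + b ^ 3 ≡ (a + b) * (2 * t + a + b) →
                    (t + a + b) ^ 2 ≡ t ^ 2 + a ^ 3 + b ^ 3
[t+a+b]²≡t²+a³+b³ t a b eq = begin
  (t + a + b) ^ 2                       ≡⟨ solve 3 (λ t a b → (t :+ a :+ b) :^ 2
                                                   := t :^ 2 :+ (a :+ b) :* (con 2 :* t :+ a :+ b)) refl t a b ⟩
  t ^ 2 + (a + b) * (2 * t + a + b)     ≡⟨ cong (t ^ 2 +_) (sym eq) ⟩
  t ^ 2 + (a ^ 3 + b ^ 3)               ≡⟨ sym (+-assoc (t ^ 2) (a ^ 3) (b ^ 3)) ⟩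
  t ^ 2 + a ^ 3 + b ^ 3                 ∎

-- The condition a² − ab + b² = N(N + 1) + a + b, with ab moved across.
Appendable : ℕ → ℕ → ℕ → Set
Appendable N a b = N * suc N + a + b + a * b ≡ a * a + b * b

appendable-cong : ∀ {N N′ a a′ b b′} → N ≡ N′ → a ≡ a′ → b ≡ b′ →
                  Appendable N a b → Appendable N′ a′ b′
appendable-cong refl refl refl p = p

sumTo-cube-extension : ∀ N a b → Appendable N a b →
  (sumTo (λ j → j) N + a + b) ^ 2 ≡ sumTo (λ j → j ^ 3) N + a ^ 3 + b ^ 3
sumTo-cube-extension N a b appendable = begin
  (T + a + b) ^ 2                       ≡⟨ [t+a+b]²≡t²+a³+b³ T a b cubes ⟩
  T ^ 2 + a ^ 3 + b ^ 3                 ≡⟨ cong (λ s → s + a ^ 3 + b ^ 3) (sym (sumTo-cube≡sumTo-id² N)) ⟩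
  sumTo (λ j → j ^ 3) N + a ^ 3 + b ^ 3 ∎
  where
  T = sumTo (λ j → j) N
  cubes : a ^ 3 + b ^ 3 ≡ (a + b) * (2 * T + a + b)
  cubes = trans (^3-+-^3≡[a+b]*[x+a+b] (N * suc N) a b appendable)
                (cong (λ x → (a + b) * (x + a + b)) (sym (2*sumTo-id≡N*suc-N N)))

c*[k+m]∸d≡c*m+e : ∀ c k d e m → c * k ≡ e + d → c * (k + m) ∸ d ≡ c * m + e
c*[k+m]∸d≡c*m+e c k d e m eq = trans (cong (_∸ d) c*[k+m]≡c*m+e+d) (m+n∸n≡m (c * m + e) d)
  where
  c*[k+m]≡c*m+e+d : c * (k + m) ≡ c * m + e + d
  c*[k+m]≡c*m+e+d = begin
    c * (k + m)       ≡⟨ *-distribˡ-+ c k m ⟩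
    c * k + c * m     ≡⟨ cong (_+ c * m) eq ⟩
    e + d + c * m     ≡⟨ +-comm (e + d) (c * m) ⟩
    c * m + (e + d)   ≡⟨ sym (+-assoc (c * m) e d) ⟩
    c * m + e + d     ∎

-- Written out rather than via Appendable, which the reflective solver does not unfold.
appendable-7m+2-8m+4-3m+3 : ∀ m → let N = 7 * m + 2; a = 8 * m + 4; b = 3 * m + 3 in
                            N * suc N + a + b + a * b ≡ a * a + b * b
appendable-7m+2-8m+4-3m+3 = solve-∀

appendable-7m+2-8m+4-5m+2 : ∀ m → let N = 7 * m + 2; a = 8 * m + 4; b = 5 * m + 2 in
                            N * suc N + a + b + a * b ≡ a * a + b * b
appendable-7m+2-8m+4-5m+2 = solve-∀

appendable-3n-3 : ∀ n → 2 ≤ n → Appendable (7 * n ∸ 12) (8 * n ∸ 12) (3 * n ∸ 3)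
appendable-3n-3 (suc (suc m)) (s≤s (s≤s z≤n)) =
  appendable-cong (sym (c*[k+m]∸d≡c*m+e 7 2 12 2 m refl)) (sym (c*[k+m]∸d≡c*m+e 8 2 12 4 m refl))
                  (sym (c*[k+m]∸d≡c*m+e 3 2 3 3 m refl)) (appendable-7m+2-8m+4-3m+3 m)

appendable-5n-8 : ∀ n → 2 ≤ n → Appendable (7 * n ∸ 12) (8 * n ∸ 12) (5 * n ∸ 8)
appendable-5n-8 (suc (suc m)) (s≤s (s≤s z≤n)) =
  appendable-cong (sym (c*[k+m]∸d≡c*m+e 7 2 12 2 m refl)) (sym (c*[k+m]∸d≡c*m+e 8 2 12 4 m refl))
                  (sym (c*[k+m]∸d≡c*m+e 5 2 8 2 m refl)) (appendable-7m+2-8m+4-5m+2 m)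

mainTheorem1 : (n : ℕ) → 2 ≤ n →
    ((sumTo (λ j → j) (7 * n ∸ 12) + (8 * n ∸ 12) + (3 * n ∸ 3)) ^ 2
      ≡ sumTo (λ j → j ^ 3) (7 * n ∸ 12) + (8 * n ∸ 12) ^ 3 + (3 * n ∸ 3) ^ 3)
    × ((sumTo (λ j → j) (7 * n ∸ 12) + (8 * n ∸ 12) + (5 * n ∸ 8)) ^ 2
      ≡ sumTo (λ j → j ^ 3) (7 * n ∸ 12) + (8 * n ∸ 12) ^ 3 + (5 * n ∸ 8) ^ 3)
mainTheorem1 n 2≤n =
    sumTo-cube-extension (7 * n ∸ 12) (8 * n ∸ 12) (3 * n ∸ 3) (appendable-3n-3 n 2≤n)
  , sumTo-cube-extension (7 * n ∸ 12) (8 * n ∸ 12) (5 * n ∸ 8) (appendable-5n-8 n 2≤n)
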